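{- Let $G$ be a graph on $n$ vertices with minimum degree $\delta(G)\ge n-3$. Then $d(G)\ge d(\mathcal{P})$ for every partition $\mathcal{P}$ of $V(G)$ into $t\ge3$ nonempty parts.
   Context: $d(G)=|E|/|V|$. For $S\subseteq V$, $d(S)=|E(S)|/|S|$ with $E(S)$ the set of edges with both endpoints in $S$; for a partition $\mathcal{P}=\{V_1,\dots,V_k\}$, $d(\mathcal{P})=\sum_i d(V_i)$. Graphs are simple. -}

module Defs where

open import Data.Nat using (ℕ; zero; suc; _+_; _<ᵇ_)
open import Data.Fin using (Fin; toℕ)
open import Data.Bool using (Bool; true; false; _∧_; if_then_else_)
open import Data.Integer using (+_)
open import Data.Rational using (ℚ; _/_; 0ℚ; _+_)
open import Relation.Binary.PropositionalEquality using (_≡_)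
open import Function.Definitions using (Surjective)

count : ∀ {n} → (Fin n → Bool) → ℕ
count {zero} p = 0
count {suc n} p = (if p Fin.zero then 1 else 0) Data.Nat.+ count (λ i → p (Fin.suc i))

sumℕ : ∀ {m} → (Fin m → ℕ) → ℕ
sumℕ {zero} f = 0
sumℕ {suc m} f = f Fin.zero Data.Nat.+ sumℕ (λ k → f (Fin.suc k))

sumℚ : ∀ {t} → (Fin t → ℚ) → ℚ
sumℚ {zero} f = 0ℚ
sumℚ {suc t} f = f Fin.zero Data.Rational.+ sumℚ (λ i → f (Fin.suc i))

record SimpleGraph (n : ℕ) : Set where
  field
    adj    : Fin n → Fin n → Bool
    sym    : ∀ i j → adj i j ≡ adj j i
    irrefl : ∀ i → adj i i ≡ false
open SimpleGraph public

degree : ∀ {n} → SimpleGraph n → Fin n → ℕ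
degree G i = count (adj G i)

edgesIn : ∀ {n} → SimpleGraph n → (Fin n → Bool) → ℕ
edgesIn {n} G S = sumℕ (λ i → count (λ j → (toℕ i <ᵇ toℕ j) ∧ adj G i j ∧ S i ∧ S j))

-- e / s as a rational (convention: 0 when s = 0; only used with s ≥ 1)
ratio : ℕ → ℕ → ℚ
ratio e zero = 0ℚ
ratio e (suc s) = (+ e) / suc s

densityOf : ∀ {n} → SimpleGraph n → (Fin n → Bool) → ℚ
densityOf G S = ratio (edgesIn G S) (count S)

density : ∀ {n} → SimpleGraph n → ℚ
density G = densityOf G (λ _ → true)

inPart : ∀ {n t} → (Fin n → Fin t) → Fin t → Fin n → Bool
inPart {t = t} p k v = Data.Fin._≟_ (p v) k |> λ d → Relation.Nullary.Decidable.⌊ d ⌋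
  where open import Function using (_|>_)
        import Relation.Nullary.Decidable

partitionDensity : ∀ {n t} → SimpleGraph n → (Fin n → Fin t) → ℚ
partitionDensity G p = sumℚ (λ k → densityOf G (inPart p k))

-- A part S spans at most |S|(|S| - 1)/2 edges, so d(S) ≤ (|S| - 1)/2, and summing over the t
-- parts gives d(P) ≤ (n - t)/2.  On the other hand the degree condition and the handshake
-- lemma give 2|E| ≥ n(n - 3), that is d(G) ≥ (n - 3)/2 ≥ (n - t)/2 as t ≥ 3.
module Submission where

open import Defs
open import Data.Nat using (ℕ; _≤_; _∸_)
open import Data.Fin using (Fin)
open import Data.Rational using (_≥_)
open import Function.Definitions using (Surjective)
open import Relation.Binary.PropositionalEquality using (_≡_)

open import Data.Nat using (zero; suc; _+_; _*_; _<_; _<ᵇ_; z≤n; s≤s)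
open import Data.Nat.Properties
  using ( module ≤-Reasoning; +-*-semiring; ≤-refl; ≤-trans; ≤-reflexive; ≤-antisym; <-asym; ≮⇒≥; <-≤-trans
        ; +-identityʳ; m≤n+m; +-mono-≤; +-mono-≤-<; *-comm; *-identityʳ
        ; *-monoʳ-≤; ∸-monoˡ-≤; ∸-monoʳ-≤; *-identityˡ; m∸n+n≡m; m+n∸n≡m; <ᵇ-reflects-< )
open import Data.Fin using (toℕ; _≟_)
open import Data.Fin.Properties using (toℕ-injective)
open import Data.Bool using (Bool; true; false; _∧_; if_then_else_; T)
open import Data.Bool.Properties using (∧-identityʳ; ∧-zeroʳ; ∧-comm; T-∧)
open import Function.Bundles using (Equivalence)
open import Data.Empty using (⊥-elim)
open import Data.Product using (_,_; proj₁; proj₂)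
open import Function using (_∘_)
open import Relation.Nullary using (¬_; ofʸ; ofⁿ)
open import Relation.Nullary.Decidable using (⌊_⌋; ⌊⌋-map′; fromWitness)
open import Relation.Unary using (_⊆_)
import Relation.Binary.PropositionalEquality as ≡
open ≡ using (refl; trans; cong; cong₂; subst; subst₂; module ≡-Reasoning)
open import Algebra.Properties.Semiring.Sum +-*-semiring
  using (sum; sum-cong-≗; ∑-comm; ∑-distrib-+; *-distribʳ-sum)
import Data.Integer as ℤ
open import Data.Integer.Properties using (pos-*; pos-+)
open import Data.Integer.Tactic.RingSolver using (solve-∀)
import Data.Rational as ℚ
open ℚ using (ℚ; toℚᵘ)
open import Data.Rational.Properties using (toℚᵘ-fromℚᵘ; toℚᵘ-homo-+; toℚᵘ-cancel-≤)
open import Data.Rational.Unnormalised using (ℚᵘ; mkℚᵘ; *≤*; *≡*; _≃_) renaming (_≤_ to _≤ᵘ_; _+_ to _+ᵘ_)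
import Data.Rational.Unnormalised.Properties as ℚᵘ

indicator : Bool → ℕ
indicator b = if b then 1 else 0

indicator-mono : ∀ {a b} → (T a → T b) → indicator a ≤ indicator b
indicator-mono {false} _ = z≤n
indicator-mono {true} {true} _ = ≤-refl
indicator-mono {true} {false} a⇒b = ⊥-elim (a⇒b _)

sumℕ≡sum : ∀ {m} (f : Fin m → ℕ) → sumℕ f ≡ sum f
sumℕ≡sum {zero} f = refl
sumℕ≡sum {suc m} f = cong (f Fin.zero +_) (sumℕ≡sum (f ∘ Fin.suc))

sum-mono : ∀ {m} {f g : Fin m → ℕ} → (∀ i → f i ≤ g i) → sum f ≤ sum g
sum-mono {zero} f≤g = z≤n
sum-mono {suc m} f≤g = +-mono-≤ (f≤g Fin.zero) (sum-mono (f≤g ∘ Fin.suc))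

sum-const : ∀ m c → sum {m} (λ _ → c) ≡ m * c
sum-const zero c = refl
sum-const (suc m) c = cong (c +_) (sum-const m c)

sum-ones : ∀ m → sum {m} (λ _ → 1) ≡ m
sum-ones m = trans (sum-const m 1) (*-identityʳ m)

sum-pred : ∀ {m} (s : Fin m → ℕ) → (∀ k → 0 < s k) → sum (λ k → s k ∸ 1) ≡ sum s ∸ m
sum-pred {m} s s>0 = begin
  X                                        ≡⟨ ≡.sym (m+n∸n≡m X m) ⟩
  X + m ∸ m                                ≡⟨ cong (λ y → X + y ∸ m) (≡.sym (sum-ones m)) ⟩
  X + sum {m} (λ _ → 1) ∸ m                ≡⟨ cong (_∸ m) (≡.sym (∑-distrib-+ (λ k → s k ∸ 1) (λ _ → 1))) ⟩
  sum (λ k → s k ∸ 1 + 1) ∸ m              ≡⟨ cong (_∸ m) (sum-cong-≗ (λ k → m∸n+n≡m (s>0 k))) ⟩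
  sum s ∸ m                                ∎
  where
  open ≡-Reasoning
  X = sum (λ k → s k ∸ 1)

count≡sum : ∀ {m} (p : Fin m → Bool) → count p ≡ sum (indicator ∘ p)
count≡sum {zero} p = refl
count≡sum {suc m} p = cong (indicator (p Fin.zero) +_) (count≡sum (p ∘ Fin.suc))

count-cong : ∀ {m} {p q : Fin m → Bool} → (∀ i → p i ≡ q i) → count p ≡ count q
count-cong {zero} p≗q = refl
count-cong {suc m} p≗q = cong₂ _+_ (cong indicator (p≗q Fin.zero)) (count-cong (p≗q ∘ Fin.suc))

count-false : ∀ m → count {m} (λ _ → false) ≡ 0
count-false zero = refl
count-false (suc m) = count-false m

count-true : ∀ m → count {m} (λ _ → true) ≡ m
count-true zero = refl
count-true (suc m) = cong suc (count-true m)

count-mono : ∀ {m} {p q : Fin m → Bool} → T ∘ p ⊆ T ∘ q → count p ≤ count q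
count-mono {zero} p⊆q = z≤n
count-mono {suc m} p⊆q = +-mono-≤ (indicator-mono p⊆q) (count-mono λ {i} → p⊆q {Fin.suc i})

count-< : ∀ {m} {p q : Fin m → Bool} i → T ∘ p ⊆ T ∘ q → ¬ T (p i) → T (q i) → count p < count q
count-< {p = p} {q} Fin.zero p⊆q ¬pᵢ qᵢ with p Fin.zero | q Fin.zero
... | false | true  = s≤s (count-mono λ {i} → p⊆q {Fin.suc i})
... | true  | _     = ⊥-elim (¬pᵢ _)
... | false | false = ⊥-elim qᵢ
count-< (Fin.suc i) p⊆q ¬pᵢ qᵢ = +-mono-≤-< (indicator-mono p⊆q) (count-< i (λ {j} → p⊆q {Fin.suc j}) ¬pᵢ qᵢ)

count-pos : ∀ {m} {p : Fin m → Bool} i → T (p i) → 0 < count p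
count-pos {p = p} Fin.zero pᵢ with p Fin.zero
... | true = s≤s z≤n
count-pos (Fin.suc i) pᵢ = <-≤-trans (count-pos i pᵢ) (m≤n+m _ _)

count-singleton : ∀ {m} (x : Fin m) → count (λ k → ⌊ x ≟ k ⌋) ≡ 1
count-singleton {suc m} Fin.zero = cong suc (count-false m)
count-singleton {suc m} (Fin.suc x) = trans (count-cong (λ k → ⌊⌋-map′ _ _ (x ≟ k))) (count-singleton x)

-- The strict order on vertex labels splits every unordered pair into exactly one ordered one.
indicator-split : ∀ {n} (R : Fin n → Fin n → Bool) → (∀ i j → R i j ≡ R j i) → (∀ i → R i i ≡ false) →
  ∀ i j → indicator (R i j) ≡ indicator ((toℕ i <ᵇ toℕ j) ∧ R i j) + indicator ((toℕ j <ᵇ toℕ i) ∧ R j i)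
indicator-split R R-sym R-irrefl i j
  with toℕ i <ᵇ toℕ j | <ᵇ-reflects-< (toℕ i) (toℕ j) | toℕ j <ᵇ toℕ i | <ᵇ-reflects-< (toℕ j) (toℕ i)
... | true  | ofʸ i<j | true  | ofʸ j<i = ⊥-elim (<-asym i<j j<i)
... | true  | _       | false | _       = ≡.sym (+-identityʳ _)
... | false | _       | true  | _       = cong indicator (R-sym i j)
... | false | ofⁿ i≮j | false | ofⁿ j≮i = cong indicator (trans (cong (R i) (≡.sym i≡j)) (R-irrefl i))
  where
  i≡j : i ≡ j
  i≡j = toℕ-injective (≤-antisym (≮⇒≥ j≮i) (≮⇒≥ i≮j))

handshake : ∀ {n} (R : Fin n → Fin n → Bool) → (∀ i j → R i j ≡ R j i) → (∀ i → R i i ≡ false) →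
  sum (λ i → count (R i)) ≡ 2 * sum (λ i → count (λ j → (toℕ i <ᵇ toℕ j) ∧ R i j))
handshake R R-sym R-irrefl = begin
  sum (λ i → count (R i))                                    ≡⟨ sum-cong-≗ (λ i → count≡sum (R i)) ⟩
  sum (λ i → sum (λ j → indicator (R i j)))                  ≡⟨ sum-cong-≗ (λ i → sum-cong-≗ (indicator-split R R-sym R-irrefl i)) ⟩
  sum (λ i → sum (λ j → A i j + A j i))                      ≡⟨ sum-cong-≗ (λ i → ∑-distrib-+ (A i) (λ j → A j i)) ⟩
  sum (λ i → sum (A i) + sum (λ j → A j i))                  ≡⟨ ∑-distrib-+ (λ i → sum (A i)) (λ i → sum (λ j → A j i)) ⟩
  sum (λ i → sum (A i)) + sum (λ i → sum (λ j → A j i))      ≡⟨ cong (sum (λ i → sum (A i)) +_) (∑-comm (λ i j → A j i)) ⟩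
  sum (λ i → sum (A i)) + sum (λ i → sum (A i))              ≡⟨ cong₂ _+_ E≡ (trans E≡ (≡.sym (+-identityʳ E))) ⟩
  2 * E                                                      ∎
  where
  open ≡-Reasoning
  A = λ i j → indicator ((toℕ i <ᵇ toℕ j) ∧ R i j)
  E = sum (λ i → count (λ j → (toℕ i <ᵇ toℕ j) ∧ R i j))
  E≡ : sum (λ i → sum (A i)) ≡ E
  E≡ = ≡.sym (sum-cong-≗ (λ i → count≡sum (λ j → (toℕ i <ᵇ toℕ j) ∧ R i j)))

module _ {n} (G : SimpleGraph n) where

  adjWithin : (Fin n → Bool) → Fin n → Fin n → Bool
  adjWithin S i j = adj G i j ∧ S i ∧ S j

  adjWithin-sym : ∀ S i j → adjWithin S i j ≡ adjWithin S j i
  adjWithin-sym S i j = cong₂ _∧_ (SimpleGraph.sym G i j) (∧-comm (S i) (S j))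

  adjWithin-irrefl : ∀ S i → adjWithin S i i ≡ false
  adjWithin-irrefl S i = cong (_∧ S i ∧ S i) (irrefl G i)

  edgesIn≡sum : ∀ S → edgesIn G S ≡ sum (λ i → count (λ j → (toℕ i <ᵇ toℕ j) ∧ adjWithin S i j))
  edgesIn≡sum S = sumℕ≡sum (λ i → count (λ j → (toℕ i <ᵇ toℕ j) ∧ adjWithin S i j))

  handshake-edgesIn : ∀ S → sum (λ i → count (adjWithin S i)) ≡ 2 * edgesIn G S
  handshake-edgesIn S = trans (handshake (adjWithin S) (adjWithin-sym S) (adjWithin-irrefl S))
                              (cong (2 *_) (≡.sym (edgesIn≡sum S)))

  sum-degree : sum (degree G) ≡ 2 * edgesIn G (λ _ → true)
  sum-degree = trans (sum-cong-≗ (λ i → count-cong (λ j → ≡.sym (∧-identityʳ (adj G i j)))))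
                     (handshake-edgesIn (λ _ → true))

  -- i itself is a vertex of S but not a neighbour of i.
  neighboursWithin-< : ∀ S i → T (S i) → count (λ j → adj G i j ∧ S j) < count S
  neighboursWithin-< S i Sᵢ = count-< i (proj₂ ∘ Equivalence.to T-∧) no-loop Sᵢ
    where
    no-loop : ¬ T (adj G i i ∧ S i)
    no-loop = subst T (cong (_∧ S i) (irrefl G i))

  neighboursWithin-≤ : ∀ S i → count (adjWithin S i) ≤ indicator (S i) * (count S ∸ 1)
  neighboursWithin-≤ S i with S i in Sᵢ
  ... | false = ≤-reflexive (trans (count-cong (λ j → ∧-zeroʳ (adj G i j))) (count-false n))
  ... | true  = ≤-trans (∸-monoˡ-≤ 1 (neighboursWithin-< S i (subst T (≡.sym Sᵢ) _)))
                        (≤-reflexive (≡.sym (*-identityˡ _)))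

  twice-edgesIn-≤ : ∀ S → 2 * edgesIn G S ≤ count S * (count S ∸ 1)
  twice-edgesIn-≤ S = begin
    2 * edgesIn G S                                    ≡⟨ ≡.sym (handshake-edgesIn S) ⟩
    sum (λ i → count (adjWithin S i))                  ≤⟨ sum-mono (neighboursWithin-≤ S) ⟩
    sum (λ i → indicator (S i) * (count S ∸ 1))        ≡⟨ ≡.sym (*-distribʳ-sum (count S ∸ 1) (indicator ∘ S)) ⟩
    sum (indicator ∘ S) * (count S ∸ 1)                ≡⟨ cong (_* (count S ∸ 1)) (≡.sym (count≡sum S)) ⟩
    count S * (count S ∸ 1)                            ∎
    where open ≤-Reasoning

  minDegree⇒twice-edges-≥ : (∀ v → n ∸ 3 ≤ degree G v) → n * (n ∸ 3) ≤ 2 * edgesIn G (λ _ → true)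
  minDegree⇒twice-edges-≥ δ = begin
    n * (n ∸ 3)                  ≡⟨ ≡.sym (sum-const n (n ∸ 3)) ⟩
    sum {n} (λ _ → n ∸ 3)        ≤⟨ sum-mono δ ⟩
    sum (degree G)               ≡⟨ sum-degree ⟩
    2 * edgesIn G (λ _ → true)   ∎
    where open ≤-Reasoning

module _ {n t} (p : Fin n → Fin t) where

  partSize : Fin t → ℕ
  partSize k = count (inPart p k)

  sum-partSize : sum partSize ≡ n
  sum-partSize = begin
    sum (λ k → count (inPart p k))                       ≡⟨ sum-cong-≗ (λ k → count≡sum (inPart p k)) ⟩
    sum (λ k → sum (λ v → indicator (inPart p k v)))     ≡⟨ ∑-comm (λ k v → indicator (inPart p k v)) ⟩
    sum (λ v → sum (λ k → indicator ⌊ p v ≟ k ⌋))        ≡⟨ sum-cong-≗ (λ v → ≡.sym (count≡sum (λ k → ⌊ p v ≟ k ⌋))) ⟩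
    sum (λ v → count (λ k → ⌊ p v ≟ k ⌋))                ≡⟨ sum-cong-≗ (λ v → count-singleton (p v)) ⟩
    sum {n} (λ _ → 1)                                    ≡⟨ sum-ones n ⟩
    n                                                    ∎
    where open ≡-Reasoning

  module _ (p-surjective : Surjective _≡_ _≡_ p) where

    partSize-pos : ∀ k → 0 < partSize k
    partSize-pos k = count-pos v (fromWitness (proj₂ (p-surjective k) refl))
      where v = proj₁ (p-surjective k)

    sum-partSize-pred : sum (λ k → partSize k ∸ 1) ≡ n ∸ t
    sum-partSize-pred = trans (sum-pred partSize partSize-pos) (cong (_∸ t) sum-partSize)

-- mkℚᵘ stores the denominator minus one, so this is a / 2.
half : ℕ → ℚᵘ
half a = mkℚᵘ (ℤ.+ a) 1

mkℚᵘ-mono-≤ : ∀ {a b c d} → a * suc d ≤ c * suc b → mkℚᵘ (ℤ.+ a) b ≤ᵘ mkℚᵘ (ℤ.+ c) d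
mkℚᵘ-mono-≤ {a} {b} {c} {d} le = *≤* (subst₂ ℤ._≤_ (pos-* a (suc d)) (pos-* c (suc b)) (ℤ.+≤+ le))

half-+ : ∀ a b → half a +ᵘ half b ≃ half (a + b)
half-+ a b = *≡* (trans (scale (ℤ.+ a) (ℤ.+ b)) (cong (ℤ._* ℤ.+ 4) (≡.sym (pos-+ a b))))
  where
  scale : ∀ (x y : ℤ.ℤ) → (x ℤ.* ℤ.+ 2 ℤ.+ y ℤ.* ℤ.+ 2) ℤ.* ℤ.+ 2 ≡ (x ℤ.+ y) ℤ.* ℤ.+ 4
  scale = solve-∀

ratio≤half : ∀ {e s} → 2 * e ≤ s * (s ∸ 1) → toℚᵘ (ratio e s) ≤ᵘ half (s ∸ 1)
ratio≤half {s = zero} _ = mkℚᵘ-mono-≤ z≤n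
ratio≤half {e} {suc s} le = begin
  toℚᵘ (ratio e (suc s))    ≃⟨ toℚᵘ-fromℚᵘ (mkℚᵘ (ℤ.+ e) s) ⟩
  mkℚᵘ (ℤ.+ e) s            ≤⟨ mkℚᵘ-mono-≤ (subst₂ _≤_ (*-comm 2 e) (*-comm (suc s) s) le) ⟩
  half s                    ∎
  where open ℚᵘ.≤-Reasoning

half≤ratio : ∀ {a e s} → suc s * a ≤ 2 * e → half a ≤ᵘ toℚᵘ (ratio e (suc s))
half≤ratio {a} {e} {s} le = begin
  half a                    ≤⟨ mkℚᵘ-mono-≤ (subst₂ _≤_ (*-comm (suc s) a) (*-comm 2 e) le) ⟩
  mkℚᵘ (ℤ.+ e) s            ≃⟨ ℚᵘ.≃-sym (toℚᵘ-fromℚᵘ (mkℚᵘ (ℤ.+ e) s)) ⟩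
  toℚᵘ (ratio e (suc s))    ∎
  where open ℚᵘ.≤-Reasoning

sumℚ≤half : ∀ {t} (f : Fin t → ℚ) (a : Fin t → ℕ) →
  (∀ k → toℚᵘ (f k) ≤ᵘ half (a k)) → toℚᵘ (sumℚ f) ≤ᵘ half (sum a)
sumℚ≤half {zero} f a _ = mkℚᵘ-mono-≤ z≤n
sumℚ≤half {suc t} f a f≤a = begin
  toℚᵘ (f Fin.zero ℚ.+ sumℚ (f ∘ Fin.suc))              ≃⟨ toℚᵘ-homo-+ (f Fin.zero) (sumℚ (f ∘ Fin.suc)) ⟩
  toℚᵘ (f Fin.zero) +ᵘ toℚᵘ (sumℚ (f ∘ Fin.suc))        ≤⟨ ℚᵘ.+-mono-≤ (f≤a Fin.zero) (sumℚ≤half (f ∘ Fin.suc) (a ∘ Fin.suc) (f≤a ∘ Fin.suc)) ⟩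
  half (a Fin.zero) +ᵘ half (sum (a ∘ Fin.suc))          ≃⟨ half-+ (a Fin.zero) (sum (a ∘ Fin.suc)) ⟩
  half (sum a)                                           ∎
  where open ℚᵘ.≤-Reasoning

partitionDensity≤half : ∀ {n t} (G : SimpleGraph n) (p : Fin n → Fin t) →
  toℚᵘ (partitionDensity G p) ≤ᵘ half (sum (λ k → partSize p k ∸ 1))
partitionDensity≤half G p =
  sumℚ≤half _ (λ k → partSize p k ∸ 1)
    (λ k → ratio≤half {edgesIn G (inPart p k)} {partSize p k} (twice-edgesIn-≤ G (inPart p k)))

density≥half : ∀ {n a} (G : SimpleGraph (suc n)) →
  suc n * a ≤ 2 * edgesIn G (λ _ → true) → half a ≤ᵘ toℚᵘ (density G)
density≥half {n} {a} G le =
  subst (λ c → half a ≤ᵘ toℚᵘ (ratio (edgesIn G (λ _ → true)) c)) (≡.sym (count-true (suc n)))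
        (half≤ratio {a} {edgesIn G (λ _ → true)} {n} le)

lemma16 : (n : ℕ) (G : SimpleGraph n) →
    (∀ v → n ∸ 3 ≤ degree G v) →
    (t : ℕ) → 3 ≤ t → (p : Fin n → Fin t) → Surjective _≡_ _≡_ p →
    density G ≥ partitionDensity G p
lemma16 zero _ _ _ (s≤s _) _ p-surjective with p-surjective Fin.zero
... | () , _
lemma16 n@(suc _) G δ t 3≤t p p-surjective = toℚᵘ-cancel-≤ (begin
  toℚᵘ (partitionDensity G p)            ≤⟨ partitionDensity≤half G p ⟩
  half (sum (λ k → partSize p k ∸ 1))    ≡⟨ cong half (sum-partSize-pred p p-surjective) ⟩
  half (n ∸ t)                           ≤⟨ density≥half G n[n∸t]≤2|E| ⟩
  toℚᵘ (density G)                       ∎)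
  where
  open ℚᵘ.≤-Reasoning
  n[n∸t]≤2|E| : n * (n ∸ t) ≤ 2 * edgesIn G (λ _ → true)
  n[n∸t]≤2|E| = ≤-trans (*-monoʳ-≤ n (∸-monoʳ-≤ n 3≤t)) (minDegree⇒twice-edges-≥ G δ)
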